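{- Let $h,k\in\mathbb{N}$, let $A\subset\mathbb{N}$ be infinite, and let $B\subset\mathbb{N}$ be a pairwise prime set with $|B|=h$ and $uB\subset A$ for some $u\in\mathbb{N}$. Let $H$ be a pairwise prime subset of $\mathbb{N}$ with $|H|=|B|$ and $\gcd(a,b)=1$ for all $a\in H$, $b\in B$. Then at least one of the following holds: (1) $A$ contains a set of the form $\{x, x n^k r\}$ for some $x,r\in\mathbb{N}$ and $n\in H$ with $r\equiv 1\pmod n$; (2) there exists $z'\in\mathbb{N}$ such that $u[z_t,z_t+h-1]\cap A=\varnothing$ for all $t\in\mathbb{N}$, where $z_t=z'+t\left(\prod_{x\in B}x^2\right)\left(\prod_{x\in H}x^{2k}\right)$.
   Context: $\mathbb{N}=\{1,2,3,\dots\}$. A set $B\subset\mathbb{N}$ is pairwise prime if $\gcd(a,b)=1$ for all $a,b\in B$ with $a\ne b$. For $a\le b$ integers, $[a,b]=\{x\in\mathbb{Z}:a\le x\le b\}$. For $X\subset\mathbb{N}$ and $u\in\mathbb{N}$, $uX=\{ux: x\in X\}$. -}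

module Defs where

open import Data.Nat using (ℕ; _+_; _*_; _∸_; _^_; _≤_; _<_)
open import Data.Nat.GCD using (gcd)
open import Data.Nat.Divisibility using (_∣_)
open import Data.List using (List; length; map)
open import Data.Nat.ListAction using (product)
open import Data.List.Membership.Propositional using (_∈_)
open import Data.List.Relation.Unary.All using (All)
open import Data.List.Relation.Unary.AllPairs using (AllPairs)
open import Data.List.Relation.Unary.Unique.Propositional using (Unique)
open import Data.Product using (Σ; _×_; ∃-syntax)
open import Relation.Binary.PropositionalEquality using (_≡_)
open import Relation.Nullary using (¬_)

-- A subset of ℕ = {1,2,3,...} is a predicate on Agda's ℕ; only positive
-- elements are relevant (membership of 0 is never used).
Pred : Set₁
Pred = ℕ → Set

Infinite : Pred → Set
Infinite A = ∀ m → ∃[ a ] (m ≤ a × A a)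

record FinSet : Set where
  constructor finSet
  field
    elems    : List ℕ
    unique   : Unique elems
    positive : All (λ x → 1 ≤ x) elems
open FinSet public

card : FinSet → ℕ
card S = length (elems S)

_∈ₛ_ : ℕ → FinSet → Set
x ∈ₛ S = x ∈ elems S

-- pairwise prime: gcd(a,b)=1 for all distinct a,b in B
-- (for a duplicate-free list, exactly the pairs of distinct positions)
PairwisePrime : FinSet → Set
PairwisePrime S = AllPairs (λ a b → gcd a b ≡ 1) (elems S)

ScaledSubset : ℕ → FinSet → Pred → Set
ScaledSubset u X A = ∀ x → x ∈ₛ X → A (u * x)

prodPow : FinSet → ℕ → ℕ
prodPow S e = product (map (λ x → x ^ e) (elems S))

Alt1 : Pred → FinSet → ℕ → Set
Alt1 A H k = ∃[ x ] ∃[ r ] ∃[ n ]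
  (1 ≤ x × 1 ≤ r × n ∈ₛ H × n ∣ (r ∸ 1) × A x × A (x * (n ^ k) * r))

zt : FinSet → FinSet → ℕ → ℕ → ℕ → ℕ
zt B H k z' t = z' + t * prodPow B 2 * prodPow H (2 * k)

Alt2 : Pred → FinSet → FinSet → ℕ → ℕ → ℕ → Set
Alt2 A B H h k u = ∃[ z' ] (1 ≤ z' × (∀ t → 1 ≤ t → ∀ y →
  zt B H k z' t ≤ y → y ≤ zt B H k z' t + h ∸ 1 → ¬ A (u * y)))

-- Write B = {b₀, …, b₍ₕ₋₁₎} and H = {n₀, …, n₍ₕ₋₁₎}.  The moduli bᵢ nᵢᵏ⁺¹ are pairwise coprime, so by the
-- Chinese remainder theorem some z' satisfies z' + i ≡ bᵢ nᵢᵏ (mod bᵢ nᵢᵏ⁺¹) for every i < h.  As k ≥ 1, each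
-- modulus divides the period ∏ b² ∏ n²ᵏ, so every z_t + i equals bᵢ nᵢᵏ r with r ≡ 1 (mod nᵢ).  Since u bᵢ ∈ A,
-- u (z_t + i) ∈ A would be an instance of (1) with x = u bᵢ.  Hence (2) holds whenever (1) fails; only this
-- case distinction is non-constructive, and the infinitude of A is not needed.

module Submission where

open import Defs
open import Data.Nat using (ℕ; zero; suc; _+_; _*_; _∸_; _^_; _≤_; _<_; z≤n; s≤s; NonZero; >-nonZero; >-nonZero⁻¹)
open import Data.Nat.Properties
  using ( *-assoc; *-mono-≤; m≤n+m; m≤m+n; ≤-trans; m^n>0; m^n≢0; ^-distribˡ-+-*; +-suc; +-identityʳ
        ; suc-injective; +-cancelʳ-≡; +-∸-assoc; m≤n+o⇒m∸n≤o; m+[n∸m]≡n)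
open import Data.Nat.Coprimality using (Coprime; gcd≡1⇒coprime; 1-coprimeTo; coprime-divisor; coprime-Bézout)
  renaming (sym to coprime-sym)
open import Data.Nat.Divisibility
  using (_∣_; divides; ∣-trans; ∣m∣n⇒∣m+n; ∣n⇒∣m*n; m∣m*n; *-pres-∣; *-monoʳ-∣)
open import Data.Nat.GCD using (gcd; module Bézout)
open import Data.Nat.ListAction using (product)
open import Data.Nat.ListAction.Properties using (∈⇒∣product; product≢0)
open import Data.Nat.Tactic.RingSolver using (solve-∀)
open import Data.List using (List; []; _∷_; length; map)
open import Data.List.Membership.Propositional using (_∈_)
open import Data.List.Membership.Propositional.Properties using (∈-map⁺)
open import Data.List.Relation.Unary.All using (All; []; _∷_; tabulate; lookup) renaming (map to All-map)
open import Data.List.Relation.Unary.All.Properties using (map⁺)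
open import Data.List.Relation.Unary.AllPairs using (AllPairs; []; _∷_) renaming (map to AllPairs-map)
open import Data.List.Relation.Unary.Any using (here; there)
open import Data.Product using (_×_; _,_; proj₁; proj₂; ∃-syntax)
open import Data.Sum using (_⊎_; inj₁; inj₂)
open import Function using (_∘_; _on_)
open import Relation.Binary.PropositionalEquality using (_≡_; refl; sym; trans; cong; subst; module ≡-Reasoning)
open import Relation.Nullary using (¬_)

coprime-*ʳ : ∀ {m a b} → Coprime m a → Coprime m b → Coprime m (a * b)
coprime-*ʳ {m} {a} m⊥a m⊥b {d} (d∣m , d∣ab) = m⊥b (d∣m , coprime-divisor d⊥a d∣ab)
  where
  d⊥a : Coprime d a
  d⊥a (c∣d , c∣a) = m⊥a (∣-trans c∣d d∣m , c∣a)

coprime-*ˡ : ∀ {m a b} → Coprime a m → Coprime b m → Coprime (a * b) m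
coprime-*ˡ a⊥m b⊥m = coprime-sym (coprime-*ʳ (coprime-sym a⊥m) (coprime-sym b⊥m))

coprime-^ʳ : ∀ {m a} e → Coprime m a → Coprime m (a ^ e)
coprime-^ʳ zero    _   = coprime-sym (1-coprimeTo _)
coprime-^ʳ (suc e) m⊥a = coprime-*ʳ m⊥a (coprime-^ʳ e m⊥a)

coprime-^ˡ : ∀ {m a} e → Coprime a m → Coprime (a ^ e) m
coprime-^ˡ e a⊥m = coprime-sym (coprime-^ʳ e (coprime-sym a⊥m))

coprime-product : ∀ {m ns} → All (Coprime m) ns → Coprime m (product ns)
coprime-product []            = coprime-sym (1-coprimeTo _)
coprime-product (m⊥n ∷ m⊥ns) = coprime-*ʳ m⊥n (coprime-product m⊥ns)

coprime-linear-congruence : ∀ {m n} .{{_ : NonZero m}} → Coprime m n → ∀ w → ∃[ x ] m ∣ w + x * n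
coprime-linear-congruence {m} {n} m⊥n w with coprime-Bézout m⊥n
... | Bézout.+- x y 1+yn≡xm = y * w , divides (w * x) (begin
  w + y * w * n    ≡⟨ factor-w w y n ⟩
  w * (1 + y * n)  ≡⟨ cong (w *_) 1+yn≡xm ⟩
  w * (x * m)      ≡⟨ sym (*-assoc w x m) ⟩
  w * x * m        ∎)
  where
  open ≡-Reasoning
  factor-w : ∀ w y n → w + y * w * n ≡ w * (1 + y * n)
  factor-w = solve-∀
coprime-linear-congruence {suc m-1} {n} m⊥n w | Bézout.-+ x y 1+xm≡yn =
  y * w * m-1 , divides (w + w * m-1 * x) (begin
  w + y * w * m-1 * n               ≡⟨ regroup w y m-1 n ⟩
  w + w * m-1 * (y * n)             ≡⟨ cong (λ q → w + w * m-1 * q) (sym 1+xm≡yn) ⟩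
  w + w * m-1 * (1 + x * suc m-1)   ≡⟨ factor-m w m-1 x ⟩
  (w + w * m-1 * x) * suc m-1       ∎)
  where
  open ≡-Reasoning
  regroup : ∀ w y m-1 n → w + y * w * m-1 * n ≡ w + w * m-1 * (y * n)
  regroup = solve-∀
  factor-m : ∀ w m-1 x → w + w * m-1 * (1 + x * suc m-1) ≡ (w + w * m-1 * x) * suc m-1
  factor-m = solve-∀

chinese-remainder : (cs : List (ℕ × ℕ)) → All (NonZero ∘ proj₁) cs →
                    AllPairs (Coprime on proj₁) cs → ∃[ z ] All (λ (m , a) → m ∣ z + a) cs
chinese-remainder []             []          []            = 0 , []
chinese-remainder ((m , a) ∷ cs) (m≢0 ∷ ≢0s) (m⊥cs ∷ ⊥cs)
  with z , solves ← chinese-remainder cs ≢0s ⊥cs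
  with x , m∣ ← coprime-linear-congruence {{m≢0}} (coprime-product (map⁺ m⊥cs)) (z + a)
  = z + x * L , subst (m ∣_) (+-right-comm z a (x * L)) m∣ ∷ tabulate still-solved
  where
  L = product (map proj₁ cs)
  +-right-comm : ∀ p q r → p + q + r ≡ p + r + q
  +-right-comm = solve-∀
  still-solved : ∀ {c} → c ∈ cs → proj₁ c ∣ z + x * L + proj₂ c
  still-solved {c} c∈cs = subst (proj₁ c ∣_) (+-right-comm z (proj₂ c) (x * L))
    (∣m∣n⇒∣m+n (lookup solves c∈cs) (∣n⇒∣m*n x (∈⇒∣product (∈-map⁺ proj₁ c∈cs))))

coprime-*^*ˡ : ∀ {b n m} k → Coprime b m → Coprime n m → Coprime (b * n ^ k * n) m
coprime-*^*ˡ k b⊥m n⊥m = coprime-*ˡ (coprime-*ˡ b⊥m (coprime-^ˡ k n⊥m)) n⊥m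

moduli-coprime : ∀ {b b′ n n′} k → Coprime b b′ → Coprime n n′ → Coprime n b′ → Coprime n′ b →
                 Coprime (b * n ^ k * n) (b′ * n′ ^ k * n′)
moduli-coprime k b⊥b′ n⊥n′ n⊥b′ n′⊥b = coprime-sym (coprime-*^*ˡ k
  (coprime-sym (coprime-*^*ˡ k b⊥b′ n⊥b′))
  (coprime-sym (coprime-*^*ˡ k (coprime-sym n′⊥b) n⊥n′)))

n^k*n∣n^[2*k] : ∀ n k → 1 ≤ k → n ^ k * n ∣ n ^ (2 * k)
n^k*n∣n^[2*k] n (suc k) _ =
  subst (n ^ suc k * n ∣_) (sym (^-distribˡ-+-* n (suc k) (suc k + 0)))
        (*-monoʳ-∣ (n ^ suc k) (m∣m*n (n ^ (k + 0))))

-- The hypothesis says y ≡ a (mod a n), written without subtraction.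
cofactor≡1-mod : ∀ a n y → 1 ≤ n → 1 ≤ y → a * n ∣ y + a * (n ∸ 1) →
                 ∃[ r ] (1 ≤ r × n ∣ r ∸ 1 × y ≡ a * r)
cofactor≡1-mod a (suc n) (suc y) _ _ (divides zero ())
cofactor≡1-mod a (suc n) (suc y) _ _ (divides (suc j) y+an≡[1+j]a[1+n]) =
  suc (j * suc n) , s≤s z≤n , divides j refl ,
  +-cancelʳ-≡ (a * n) (suc y) (a * suc (j * suc n)) (trans y+an≡[1+j]a[1+n] (expand a n j))
  where
  expand : ∀ a n j → suc j * (a * suc n) ≡ a * suc (j * suc n) + a * n
  expand = solve-∀

∸-<-window : ∀ m n h → 1 ≤ h → n ≤ m + h ∸ 1 → n ∸ m < h
∸-<-window m n (suc h) _ n≤m+h =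
  s≤s (m≤n+o⇒m∸n≤o n m (subst (n ≤_) (+-∸-assoc m (s≤s (z≤n {h}))) n≤m+h))

module Congruences (k : ℕ) where

  -- Asks z + o ≡ b nᵏ (mod b nᵏ⁺¹), written without subtraction.
  congruence : ℕ → ℕ → ℕ → ℕ × ℕ
  congruence o b n = b * n ^ k * n , o + b * n ^ k * (n ∸ 1)

  system : ℕ → List ℕ → List ℕ → List (ℕ × ℕ)
  system o (b ∷ bs) (n ∷ ns) = congruence o b n ∷ system (suc o) bs ns
  system o []       _        = []
  system o (_ ∷ _)  []       = []

  All-system : ∀ {P : ℕ × ℕ → Set} o bs ns →
               (∀ {b n} o → b ∈ bs → n ∈ ns → P (congruence o b n)) → All P (system o bs ns)
  All-system o (b ∷ bs) (n ∷ ns) p =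
    p o (here refl) (here refl) ∷ All-system (suc o) bs ns (λ o b∈ n∈ → p o (there b∈) (there n∈))
  All-system o []       _        _ = []
  All-system o (_ ∷ _)  []       _ = []

  system-coprime : ∀ o {bs ns} → AllPairs Coprime bs → AllPairs Coprime ns →
                   (∀ {a b} → a ∈ ns → b ∈ bs → Coprime a b) → AllPairs (Coprime on proj₁) (system o bs ns)
  system-coprime o {b ∷ bs} {n ∷ ns} (b⊥bs ∷ ⊥bs) (n⊥ns ∷ ⊥ns) ns⊥bs =
    All-system (suc o) bs ns (λ _ b′∈ n′∈ → moduli-coprime k (lookup b⊥bs b′∈) (lookup n⊥ns n′∈)
                                              (ns⊥bs (here refl) (there b′∈)) (ns⊥bs (there n′∈) (here refl)))
    ∷ system-coprime (suc o) ⊥bs ⊥ns (λ a∈ b∈ → ns⊥bs (there a∈) (there b∈))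
  system-coprime o {[]}         _ _ _ = []
  system-coprime o {_ ∷ _} {[]} _ _ _ = []

  ∈-system : ∀ o bs ns → length bs ≡ length ns → ∀ {i} → i < length bs →
             ∃[ b ] ∃[ n ] (b ∈ bs × n ∈ ns × congruence (o + i) b n ∈ system o bs ns)
  ∈-system o (b ∷ bs) (n ∷ ns) _ {zero} _ =
    b , n , here refl , here refl , here (cong (λ x → congruence x b n) (+-identityʳ o))
  ∈-system o (b ∷ bs) (n ∷ ns) |bs|≡|ns| {suc i} (s≤s i<|bs|)
    with b′ , n′ , b′∈ , n′∈ , c∈ ← ∈-system (suc o) bs ns (suc-injective |bs|≡|ns|) i<|bs| =
    b′ , n′ , there b′∈ , there n′∈ ,
    there (subst (λ x → congruence x b′ n′ ∈ system (suc o) bs ns) (sym (+-suc o i)) c∈)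

open Congruences using (system)

record Factorisation (B H : FinSet) (k y : ℕ) : Set where
  constructor factorisation
  field
    b n r    : ℕ
    b∈B      : b ∈ₛ B
    n∈H      : n ∈ₛ H
    r≥1      : 1 ≤ r
    n∣r∸1    : n ∣ r ∸ 1
    y≡b*nᵏ*r : y ≡ b * n ^ k * r

period : FinSet → FinSet → ℕ → ℕ
period B H k = prodPow B 2 * prodPow H (2 * k)

period≥1 : ∀ B H k → 1 ≤ period B H k
period≥1 B H k = *-mono-≤ (prodPow≥1 B 2) (prodPow≥1 H (2 * k))
  where
  prodPow≥1 : ∀ S e → 1 ≤ prodPow S e
  prodPow≥1 S e =
    >-nonZero⁻¹ _ {{product≢0 (map⁺ (All-map (λ s≥1 → m^n≢0 _ e {{>-nonZero s≥1}}) (positive S)))}}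

b*nᵏ*n∣period : ∀ {b n} B H k → 1 ≤ k → b ∈ₛ B → n ∈ₛ H → b * n ^ k * n ∣ period B H k
b*nᵏ*n∣period {b} {n} B H k k≥1 b∈B n∈H = subst (_∣ period B H k) (sym (*-assoc b (n ^ k) n))
  (*-pres-∣ (∣-trans (m∣m*n {b} (b * 1)) (∈⇒∣product (∈-map⁺ (_^ 2) b∈B)))
            (∣-trans (n^k*n∣n^[2*k] n k k≥1) (∈⇒∣product (∈-map⁺ (_^ (2 * k)) n∈H))))

system-solvable : ∀ k (B H : FinSet) → PairwisePrime B → PairwisePrime H →
                  (∀ a b → a ∈ₛ H → b ∈ₛ B → gcd a b ≡ 1) →
                  ∃[ z ] All (λ (m , a) → m ∣ z + a) (system k 0 (elems B) (elems H))
system-solvable k B H ppB ppH H⊥B = chinese-remainder _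
  (All-system 0 _ _ λ _ b∈B n∈H →
    >-nonZero (modulus≥1 (lookup (positive B) b∈B) (lookup (positive H) n∈H)))
  (system-coprime 0 (AllPairs-map gcd≡1⇒coprime ppB) (AllPairs-map gcd≡1⇒coprime ppH)
     (λ a∈H b∈B → gcd≡1⇒coprime (H⊥B _ _ a∈H b∈B)))
  where
  open Congruences k using (All-system; system-coprime)
  modulus≥1 : ∀ {b n} → 1 ≤ b → 1 ≤ n → 1 ≤ b * n ^ k * n
  modulus≥1 {n = n} b≥1 n≥1 = *-mono-≤ (*-mono-≤ b≥1 (m^n>0 n {{>-nonZero n≥1}} k)) n≥1

solution⇒blocks-factorise : ∀ k → 1 ≤ k → (B H : FinSet) → card H ≡ card B →
  ∀ z → All (λ (m , a) → m ∣ z + a) (system k 0 (elems B) (elems H)) →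
  ∀ t i → i < card B → Factorisation B H k (zt B H k (z + period B H k) t + i)
solution⇒blocks-factorise k k≥1 B H |H|≡|B| z solves t i i<|B| =
  factorisation-at (∈-system 0 (elems B) (elems H) (sym |H|≡|B|) i<|B|)
  where
  open Congruences k using (congruence; ∈-system)
  pB = prodPow B 2
  pH = prodPow H (2 * k)
  y = zt B H k (z + period B H k) t + i
  y≥1 : 1 ≤ y
  y≥1 = ≤-trans (period≥1 B H k) (≤-trans (m≤n+m _ z) (≤-trans (m≤m+n _ _) (m≤m+n _ i)))
  regroup : ∀ z pB pH t i c → z + pB * pH + t * pB * pH + i + c ≡ z + (i + c) + suc t * (pB * pH)
  regroup = solve-∀
  y≡b*nᵏ-mod : ∀ {b n} → b ∈ₛ B → n ∈ₛ H → congruence i b n ∈ system k 0 (elems B) (elems H) →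
               b * n ^ k * n ∣ y + b * n ^ k * (n ∸ 1)
  y≡b*nᵏ-mod {b} {n} b∈B n∈H c∈ = subst (b * n ^ k * n ∣_) (sym (regroup z pB pH t i _))
    (∣m∣n⇒∣m+n (lookup solves c∈) (∣n⇒∣m*n (suc t) (b*nᵏ*n∣period B H k k≥1 b∈B n∈H)))
  factorisation-at : ∃[ b ] ∃[ n ] (b ∈ₛ B × n ∈ₛ H × congruence i b n ∈ system k 0 (elems B) (elems H)) →
                     Factorisation B H k y
  factorisation-at (b , n , b∈B , n∈H , c∈)
    with r , r≥1 , n∣r∸1 , y≡ ← cofactor≡1-mod (b * n ^ k) n y (lookup (positive H) n∈H) y≥1
                                               (y≡b*nᵏ-mod b∈B n∈H c∈)
    = factorisation b n r b∈B n∈H r≥1 n∣r∸1 y≡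

blocks-factorise : ∀ k → 1 ≤ k → (B H : FinSet) → PairwisePrime B → PairwisePrime H →
  card H ≡ card B → (∀ a b → a ∈ₛ H → b ∈ₛ B → gcd a b ≡ 1) →
  ∃[ z' ] (1 ≤ z' × ∀ t i → i < card B → Factorisation B H k (zt B H k z' t + i))
blocks-factorise k k≥1 B H ppB ppH |H|≡|B| H⊥B with z , solves ← system-solvable k B H ppB ppH H⊥B =
  z + period B H k , ≤-trans (period≥1 B H k) (m≤n+m _ z) ,
  solution⇒blocks-factorise k k≥1 B H |H|≡|B| z solves

factorisation⇒Alt1 : ∀ {B H k u y} (A : Pred) → 1 ≤ u → ScaledSubset u B A →
                     Factorisation B H k y → A (u * y) → Alt1 A H k
factorisation⇒Alt1 {B} {k = k} {u} A u≥1 uB⊆A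
                   (factorisation b n r b∈B n∈H r≥1 n∣r∸1 refl) A[uy] =
  u * b , r , n , *-mono-≤ u≥1 (lookup (positive B) b∈B) , r≥1 , n∈H , n∣r∸1 ,
  uB⊆A b b∈B , subst A (reassoc u b (n ^ k) r) A[uy]
  where
  reassoc : ∀ u b m r → u * (b * m * r) ≡ u * b * m * r
  reassoc = solve-∀

corollary2p3 : (h k : ℕ) → 1 ≤ h → 1 ≤ k → (A : Pred) → Infinite A →
    (B : FinSet) → PairwisePrime B → card B ≡ h →
    (u : ℕ) → 1 ≤ u → ScaledSubset u B A →
    (H : FinSet) → PairwisePrime H → card H ≡ card B →
    (∀ a b → a ∈ₛ H → b ∈ₛ B → gcd a b ≡ 1) →
    ¬ ¬ (Alt1 A H k ⊎ Alt2 A B H h k u)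
corollary2p3 h k h≥1 k≥1 A _ B ppB refl u u≥1 uB⊆A H ppH |H|≡|B| H⊥B ¬alts
  with z' , z'≥1 , factorise ← blocks-factorise k k≥1 B H ppB ppH |H|≡|B| H⊥B =
  ¬alts (inj₂ (z' , z'≥1 , avoids))
  where
  avoids : ∀ t → 1 ≤ t → ∀ y → zt B H k z' t ≤ y → y ≤ zt B H k z' t + card B ∸ 1 → ¬ A (u * y)
  avoids t _ y zₜ≤y y≤zₜ+h-1 A[uy] = ¬alts (inj₁ (factorisation⇒Alt1 A u≥1 uB⊆A y-factorises A[uy]))
    where
    y-factorises : Factorisation B H k y
    y-factorises = subst (Factorisation B H k) (m+[n∸m]≡n zₜ≤y)
      (factorise t (y ∸ zt B H k z' t) (∸-<-window (zt B H k z' t) y (card B) h≥1 y≤zₜ+h-1))
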